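{- Let $S=\langle1,2,\dots,n\rangle$. Starting with an arbitrary BST~$T_0$, the cost of running GreedyFuture on search sequence~$S$ is~$O(n)$.
   Context: BST model: an $n$-node BST on keys $\{1,\dots,n\}$; the $i$-th search for $s_i$ accesses a subtree $\tau_i$ containing the root and $s_i$ (the search path) and reconfigures it into a tree $\tau'_i$ on the same nodes; cost is $\sum_i|\tau_i|$. GreedyFuture is the offline BST algorithm that touches only the search path $\tau_i$ and then rearranges it: if $i=m$ it does nothing; if $s_{i+1}\in\tau_i$ it makes $s_{i+1}$ the root of $\tau'_i$; otherwise it makes the predecessor and successor of $s_{i+1}$ within $\tau_i$ the root and the root's right child (only one if the other does not exist); it then recursively arranges the remaining nodes less than / greater than these fixed nodes using the corresponding subsequences of future searches $\langle s_{i+1},\dots,s_m\rangle$. -}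

module Defs where

open import Data.Nat using (ℕ; zero; suc; _+_; _<?_; _≟_; _<ᵇ_; _≡ᵇ_)
open import Data.Bool using (Bool; true; false; if_then_else_)
open import Data.List using (List; []; _∷_; _++_; length; filter; head; last; [_])
open import Data.Bool.ListAction using (any)
open import Data.Maybe using (Maybe; just; nothing)
open import Data.Product using (_×_; _,_; proj₁; proj₂)

data Tree : Set where
  leaf : Tree
  node : Tree → ℕ → Tree → Tree

-- In-order traversal.  A tree T is a BST on keys {1,…,n} iff
-- inorder T ≡ [1,2,…,n].
inorder : Tree → List ℕ
inorder leaf         = []
inorder (node l k r) = inorder l ++ k ∷ inorder r

-- Search for s: returns the keys on the search path (root to s), sorted
-- increasingly, together with the subtrees hanging off the search path,
-- listed in in-order (symmetric) order.
searchPath : ℕ → Tree → List ℕ × List Tree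
searchPath s leaf = [] , [ leaf ]
searchPath s (node l k r) with s <ᵇ k | k <ᵇ s
... | true  | _     = let pr = searchPath s l in proj₁ pr ++ [ k ] , proj₂ pr ++ [ r ]
... | false | true  = let pr = searchPath s r in k ∷ proj₁ pr , l ∷ proj₂ pr
... | false | false = [ k ] , l ∷ r ∷ []

below : ℕ → List ℕ → List ℕ
below x = filter (λ y → y <? x)

above : ℕ → List ℕ → List ℕ
above x = filter (λ y → x <? y)

-- A canonical arrangement of a sorted key list (used only when no future
-- search falls in the range; any arrangement is allowed by the paper).
chain : List ℕ → Tree
chain []       = leaf
chain (k ∷ ks) = node leaf k (chain ks)

-- The first argument is fuel; with fuel
-- ≥ length P (as used below) it never runs out, since every recursive
-- call is on a strictly smaller key set.
arrange : ℕ → List ℕ → List ℕ → Tree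
arrange zero    P fut = chain P
arrange (suc f) P []  = chain P
arrange (suc f) P (x ∷ rest) with any (x ≡ᵇ_) P
... | true  = node (arrange f (below x P) (below x fut)) x
                   (arrange f (above x P) (above x fut))
  where fut = x ∷ rest
... | false with last (below x P) | head (above x P)
...   | just p  | just q  = node (arrange f (below p P) (below p fut)) p
                                 (node leaf q (arrange f (above q P) (above q fut)))
  where fut = x ∷ rest
...   | just p  | nothing = node (arrange f (below p P) (below p fut)) p leaf
  where fut = x ∷ rest
...   | nothing | just q  = node leaf q (arrange f (above q P) (above q fut))
  where fut = x ∷ rest
...   | nothing | nothing = leaf

fill : Tree → List Tree → Tree × List Tree
fill leaf []            = leaf , []
fill leaf (h ∷ hs)      = h , hs
fill (node l k r) hs with fill l hs
... | l' , hs' with fill r hs'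
...   | r' , hs'' = node l' k r' , hs''

greedyStep : ℕ → List ℕ → Tree → Tree
greedyStep s []  T = T
greedyStep s fut T =
  let pr = searchPath s T
      P  = proj₁ pr
  in proj₁ (fill (arrange (length P) P fut) (proj₂ pr))

greedyCost : Tree → List ℕ → ℕ
greedyCost T []        = 0
greedyCost T (s ∷ fut) = length (proj₁ (searchPath s T)) + greedyCost (greedyStep s fut T) fut

module Submission where

-- When s is searched, the keys ≥ s still form one subtree B, hanging
-- off a right spine `cs` of smaller keys (the spine context; it is empty at the start and
-- has one node afterwards).  The path to s is cs, then s = min B, then the left spine ps of
-- B above s.  GreedyFuture makes s (or s+1, if s+1 is the next key of ps) the root and
-- rotates ps into a right-going chain: this is the content of the arrangement lemmas
-- `arrange-chain`, `arrange-hit`, `arrange-miss` and the step lemmas `step-miss`,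
-- `step-hit`, `step-root`.  Hence the cost |cs| + 1 + |ps| is paid for by the potential
-- (total size of the left subtrees along the right spine), which drops by about |ps|.
-- `cost-bound` turns this into: cost ≤ 4·(number of searches) + potential + 2·|cs|; the
-- theorem follows since the initial potential is at most the number of keys n.

open import Defs
open import Data.Nat using (ℕ; suc; _*_; _≤_)
open import Data.List using (applyUpTo)
open import Data.Product using (∃-syntax)
open import Relation.Binary.PropositionalEquality using (_≡_)

open import Data.Nat using (zero; _+_; _<_; _<?_; _<ᵇ_; _≡ᵇ_; z≤n; s≤s)
open import Data.Nat.Properties
open import Data.Nat.Tactic.RingSolver using (solve-∀)
open import Data.Bool using (true; false; T)
open import Data.Bool.Properties using (∨-zeroʳ)
open import Data.Bool.ListAction using (any)
open import Data.Unit using (tt)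
open import Data.List using (List; []; _∷_; _++_; [_]; length; map; head; last)
open import Data.Nat.ListAction using (sum)
open import Data.List.Properties
  using (++-assoc; ++-identityʳ; length-++; length-map; length-applyUpTo; ∷-injective; filter-++; filter-all; filter-none; filter-reject)
open import Data.List.Relation.Unary.All as All using (All; []; _∷_)
open import Data.List.Relation.Unary.All.Properties using (++⁺)
open import Data.Maybe using (just; nothing)
open import Data.Product using (Σ-syntax; _×_; _,_; proj₁; proj₂; map₁)
open import Data.Sum using (inj₁; inj₂)
open import Function using (_∘_)
open import Relation.Nullary using (¬_; contradiction)
open import Relation.Binary.PropositionalEquality
  using (_≢_; refl; sym; trans; cong; cong₂; subst; module ≡-Reasoning)

range : ℕ → ℕ → List ℕ
range a zero    = []
range a (suc j) = a ∷ range (suc a) j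

applyUpTo≡range : ∀ (f : ℕ → ℕ) a j → (∀ i → f i ≡ a + i) → applyUpTo f j ≡ range a j
applyUpTo≡range f a zero    f≗a+ = refl
applyUpTo≡range f a (suc j) f≗a+ =
  cong₂ _∷_ (trans (f≗a+ 0) (+-identityʳ a))
            (applyUpTo≡range (f ∘ suc) (suc a) j (λ i → trans (f≗a+ (suc i)) (+-suc a i)))

data Ascending : ℕ → List ℕ → Set where
  done : ∀ {a} → Ascending a []
  next : ∀ {a q qs} → a ≤ q → Ascending (suc q) qs → Ascending a (q ∷ qs)

ascending-range : ∀ a j → Ascending a (range a j)
ascending-range a zero    = done
ascending-range a (suc j) = next ≤-refl (ascending-range (suc a) j)

ascending-lower : ∀ {a xs} → Ascending a xs → All (a ≤_) xs
ascending-lower done           = []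
ascending-lower (next a≤q asc) = a≤q ∷ All.map (≤-trans (m≤n⇒m≤1+n a≤q)) (ascending-lower asc)

ascending-drop : ∀ {a k ys} xs → Ascending a (xs ++ k ∷ ys) → a ≤ k × Ascending (suc k) ys
ascending-drop []       (next a≤k asc) = a≤k , asc
ascending-drop (x ∷ xs) (next a≤x asc) = map₁ (≤-trans (m≤n⇒m≤1+n a≤x)) (ascending-drop xs asc)

range-suffix : ∀ {a j ys} xs → xs ++ a ∷ ys ≡ range a (suc j) → ys ≡ range (suc a) j
range-suffix []       eq = proj₂ (∷-injective eq)
range-suffix {a} {j} (x ∷ xs) eq = contradiction (proj₁ (ascending-drop xs ascending-tail)) (n≮n a)
  where
  ascending-tail : Ascending (suc a) (xs ++ a ∷ _)
  ascending-tail = subst (Ascending (suc a)) (sym (proj₂ (∷-injective eq))) (ascending-range (suc a) j)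

last-snoc : ∀ {A : Set} (xs : List A) x → last (xs ++ [ x ]) ≡ just x
last-snoc []           x = refl
last-snoc (y ∷ [])     x = refl
last-snoc (y ∷ z ∷ xs) x = last-snoc (z ∷ xs) x

below-none : ∀ {x xs} → All (x ≤_) xs → below x xs ≡ []
below-none x≤xs = filter-none (λ y → y <? _) (All.map ≤⇒≯ x≤xs)

above-none : ∀ {x xs} → All (_≤ x) xs → above x xs ≡ []
above-none xs≤x = filter-none (λ y → _ <? y) (All.map ≤⇒≯ xs≤x)

above-all : ∀ {x xs} → All (x <_) xs → above x xs ≡ xs
above-all = filter-all (λ y → _ <? y)

below-keep : ∀ {x} xs ys → All (_< x) xs → below x (xs ++ ys) ≡ xs ++ below x ys
below-keep xs ys xs<x = trans (filter-++ (λ y → y <? _) xs ys) (cong (_++ _) (filter-all (λ y → y <? _) xs<x))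

below-split : ∀ {x} xs ys → All (_< x) xs → All (x ≤_) ys → below x (xs ++ ys) ≡ xs
below-split xs ys xs<x x≤ys = trans (below-keep xs ys xs<x) (trans (cong (xs ++_) (below-none x≤ys)) (++-identityʳ xs))

above-skip : ∀ {x} xs ys → All (_≤ x) xs → above x (xs ++ ys) ≡ above x ys
above-skip xs ys xs≤x = trans (filter-++ (λ y → _ <? y) xs ys) (cong (_++ _) (above-none xs≤x))

above-after : ∀ {x} xs ys → All (_≤ x) xs → All (x <_) ys → above x (xs ++ ys) ≡ ys
above-after xs ys xs≤x x<ys = trans (above-skip xs ys xs≤x) (above-all x<ys)

below-range : ∀ {q a} j → q ≤ a → below q (range a j) ≡ []
below-range {a = a} j q≤a = below-none (All.map (≤-trans q≤a) (ascending-lower (ascending-range a j)))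

above-range : ∀ {q a} j → a ≤ q → ∃[ j′ ] above q (range a j) ≡ range (suc q) j′
above-range zero _ = 0 , refl
above-range {q} {a} (suc j) a≤q with m≤n⇒m<n∨m≡n a≤q
... | inj₂ refl = j , trans (filter-reject (λ y → q <? y) (n≮n q))
                             (above-all (ascending-lower (ascending-range (suc q) j)))
... | inj₁ a<q with above-range j a<q
...   | j′ , eq = j′ , trans (filter-reject (λ y → q <? y) (<⇒≯ a<q)) eq

≡true : ∀ {b} → T b → b ≡ true
≡true {true} _ = refl

≡false : ∀ {b} → ¬ T b → b ≡ false
≡false {false} _   = refl
≡false {true}  ¬tt = contradiction tt ¬tt

<ᵇ-true : ∀ {m n} → m < n → (m <ᵇ n) ≡ true
<ᵇ-true = ≡true ∘ <⇒<ᵇ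

<ᵇ-false : ∀ {m n} → n ≤ m → (m <ᵇ n) ≡ false
<ᵇ-false {m} {n} n≤m = ≡false (≤⇒≯ n≤m ∘ <ᵇ⇒< m n)

any-≡ᵇ-true : ∀ x xs ys → any (x ≡ᵇ_) (xs ++ x ∷ ys) ≡ true
any-≡ᵇ-true x []       ys rewrite ≡true (≡⇒≡ᵇ x x refl) = refl
any-≡ᵇ-true x (y ∷ xs) ys rewrite any-≡ᵇ-true x xs ys = ∨-zeroʳ (x ≡ᵇ y)

any-≡ᵇ-false : ∀ {x xs} → All (x ≢_) xs → any (x ≡ᵇ_) xs ≡ false
any-≡ᵇ-false {x} []                   = refl
any-≡ᵇ-false {x} {y ∷ _} (x≢y ∷ x∉xs)
  rewrite ≡false {x ≡ᵇ y} (x≢y ∘ ≡ᵇ⇒≡ x y) = any-≡ᵇ-false x∉xs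

arrange-member : ∀ f P x rest → any (x ≡ᵇ_) P ≡ true →
  arrange (suc f) P (x ∷ rest) ≡ node (arrange f (below x P) (below x (x ∷ rest))) x
                                      (arrange f (above x P) (above x (x ∷ rest)))
arrange-member f P x rest x∈P rewrite x∈P = refl

arrange-between : ∀ f P x rest p q → any (x ≡ᵇ_) P ≡ false →
  last (below x P) ≡ just p → head (above x P) ≡ just q →
  arrange (suc f) P (x ∷ rest) ≡ node (arrange f (below p P) (below p (x ∷ rest))) p
                                      (node leaf q (arrange f (above q P) (above q (x ∷ rest))))
arrange-between f P x rest p q x∉P pred succ rewrite x∉P | pred | succ = refl

arrange-above-all : ∀ f P x rest p → any (x ≡ᵇ_) P ≡ false →
  last (below x P) ≡ just p → head (above x P) ≡ nothing →
  arrange (suc f) P (x ∷ rest) ≡ node (arrange f (below p P) (below p (x ∷ rest))) p leaf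
arrange-above-all f P x rest p x∉P pred succ rewrite x∉P | pred | succ = refl

arrange-below-all : ∀ f P x rest q → any (x ≡ᵇ_) P ≡ false →
  last (below x P) ≡ nothing → head (above x P) ≡ just q →
  arrange (suc f) P (x ∷ rest) ≡ node leaf q (arrange f (above q P) (above q (x ∷ rest)))
arrange-below-all f P x rest q x∉P pred succ rewrite x∉P | pred | succ = refl

arrange-[] : ∀ f P → arrange f P [] ≡ chain P
arrange-[] zero    P = refl
arrange-[] (suc f) P = refl

mutual
  arrange-chain : ∀ f {a} j Q → Ascending a Q → length Q ≤ f → arrange f Q (range a j) ≡ chain Q
  arrange-chain f       zero    Q       _ _ = arrange-[] f Q
  arrange-chain zero    (suc j) []      _ _ = refl
  arrange-chain (suc f) (suc j) []      _ _ = refl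
  arrange-chain zero    (suc j) (q ∷ Q) _ ()
  arrange-chain (suc f) {a} (suc j) (q ∷ Q) (next a≤q asc) (s≤s len) with m≤n⇒m<n∨m≡n a≤q
  ... | inj₂ refl = arrange-hit (suc f) j [] Q [] asc (s≤s len)
  ... | inj₁ a<q  with above-range (suc j) (<⇒≤ a<q)
  ...   | j′ , future-above = begin
      arrange (suc f) (q ∷ Q) (range a (suc j))
    ≡⟨ arrange-below-all f (q ∷ Q) a (range (suc a) j) q (any-≡ᵇ-false a∉) (cong last none-below) (cong head all-above) ⟩
      node leaf q (arrange f (above q (q ∷ Q)) (above q (range a (suc j))))
    ≡⟨ cong (node leaf q) (cong₂ (arrange f) (above-after [ q ] Q (≤-refl ∷ []) Q>q) future-above) ⟩
      node leaf q (arrange f Q (range (suc q) j′))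
    ≡⟨ cong (node leaf q) (arrange-chain f j′ Q asc len) ⟩
      node leaf q (chain Q) ∎
    where
    open ≡-Reasoning
    Q>q : All (q <_) Q
    Q>q = ascending-lower asc
    q∷Q>a : All (a <_) (q ∷ Q)
    q∷Q>a = a<q ∷ All.map (<-trans a<q) Q>q
    a∉ : All (a ≢_) (q ∷ Q)
    a∉ = All.map <⇒≢ q∷Q>a
    none-below : below a (q ∷ Q) ≡ []
    none-below = below-none (All.map <⇒≤ q∷Q>a)
    all-above : above a (q ∷ Q) ≡ q ∷ Q
    all-above = above-all q∷Q>a

  -- When the next search a is among the keys, it becomes the root; the smaller keys have no
  -- future searches left and form a chain, the larger ones form a chain by `arrange-chain`.
  arrange-hit : ∀ f {a} j L Q → All (_< a) L → Ascending (suc a) Q → length Q < f →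
    arrange f (L ++ a ∷ Q) (range a (suc j)) ≡ node (chain L) a (chain Q)
  arrange-hit (suc f) {a} j L Q L<a asc (s≤s len) with above-range (suc j) (≤-refl {a})
  ... | j′ , future-above = begin
      arrange (suc f) P (range a (suc j))
    ≡⟨ arrange-member f P a (range (suc a) j) (any-≡ᵇ-true a L Q) ⟩
      node (arrange f (below a P) (below a (range a (suc j)))) a
           (arrange f (above a P) (above a (range a (suc j))))
    ≡⟨ cong₂ (λ l r → node l a r) lower upper ⟩
      node (chain L) a (chain Q) ∎
    where
    open ≡-Reasoning
    P = L ++ a ∷ Q
    Q>a : All (a <_) Q
    Q>a = ascending-lower asc
    lower : arrange f (below a P) (below a (range a (suc j))) ≡ chain L
    lower = trans (cong₂ (arrange f) (below-split L (a ∷ Q) L<a (≤-refl ∷ All.map <⇒≤ Q>a)) (below-range {a} (suc j) ≤-refl))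
                  (arrange-[] f L)
    upper : arrange f (above a P) (above a (range a (suc j))) ≡ chain Q
    upper = trans (cong₂ (arrange f) (trans (above-skip L (a ∷ Q) (All.map <⇒≤ L<a)) (above-after [ a ] Q (≤-refl ∷ []) Q>a))
                                     future-above)
                  (arrange-chain f j′ Q asc len)

module Gap {a ℓ : ℕ} (L Q : List ℕ) (L<ℓ : All (_< ℓ) L) (ℓ<a : ℓ < a) (Q>a : All (a <_) Q) where
  private
    L<a : All (_< a) L
    L<a = All.map (λ y<ℓ → <-trans y<ℓ ℓ<a) L<ℓ
    regroup : L ++ ℓ ∷ Q ≡ (L ++ [ ℓ ]) ++ Q
    regroup = sym (++-assoc L [ ℓ ] Q)
    L∷ℓ<a : All (_< a) (L ++ [ ℓ ])
    L∷ℓ<a = ++⁺ L<a (ℓ<a ∷ [])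

  absent : any (a ≡ᵇ_) (L ++ ℓ ∷ Q) ≡ false
  absent = any-≡ᵇ-false (++⁺ (All.map >⇒≢ L<a) (>⇒≢ ℓ<a ∷ All.map <⇒≢ Q>a))

  predecessor : last (below a (L ++ ℓ ∷ Q)) ≡ just ℓ
  predecessor = trans (cong (last ∘ below a) regroup)
                      (trans (cong last (below-split (L ++ [ ℓ ]) Q L∷ℓ<a (All.map <⇒≤ Q>a))) (last-snoc L ℓ))

  upper-part : above a (L ++ ℓ ∷ Q) ≡ Q
  upper-part = trans (cong (above a) regroup) (above-after (L ++ [ ℓ ]) Q (All.map <⇒≤ L∷ℓ<a) Q>a)

  lower-part : below ℓ (L ++ ℓ ∷ Q) ≡ L
  lower-part = below-split L (ℓ ∷ Q) L<ℓ (≤-refl ∷ All.map (λ a<y → <⇒≤ (<-trans ℓ<a a<y)) Q>a)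

arrange-miss : ∀ f {a} j L ℓ Q → All (_< ℓ) L → ℓ < a → Ascending (suc a) Q → length Q < f →
  arrange f (L ++ ℓ ∷ Q) (range a (suc j)) ≡ node (chain L) ℓ (chain Q)
arrange-miss (suc f) {a} j L ℓ [] L<ℓ ℓ<a done _ = begin
    arrange (suc f) (L ++ [ ℓ ]) (range a (suc j))
  ≡⟨ arrange-above-all f (L ++ [ ℓ ]) a (range (suc a) j) ℓ absent predecessor (cong head upper-part) ⟩
    node (arrange f (below ℓ (L ++ [ ℓ ])) (below ℓ (range a (suc j)))) ℓ leaf
  ≡⟨ cong (λ l → node l ℓ leaf) (trans (cong₂ (arrange f) lower-part (below-range (suc j) (<⇒≤ ℓ<a))) (arrange-[] f L)) ⟩
    node (chain L) ℓ leaf ∎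
  where
  open ≡-Reasoning
  open Gap L [] L<ℓ ℓ<a []
arrange-miss (suc f) {a} j L ℓ (q ∷ Q) L<ℓ ℓ<a asc@(next a<q asc′) (s≤s len)
  with above-range (suc j) (<⇒≤ a<q)
... | j′ , future-above = begin
    arrange (suc f) P (range a (suc j))
  ≡⟨ arrange-between f P a (range (suc a) j) ℓ q absent predecessor (cong head upper-part) ⟩
    node (arrange f (below ℓ P) (below ℓ (range a (suc j)))) ℓ
         (node leaf q (arrange f (above q P) (above q (range a (suc j)))))
  ≡⟨ cong₂ (λ l r → node l ℓ (node leaf q r)) lower upper ⟩
    node (chain L) ℓ (node leaf q (chain Q)) ∎
  where
  open ≡-Reasoning
  P = L ++ ℓ ∷ q ∷ Q
  q∷Q>a : All (a <_) (q ∷ Q)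
  q∷Q>a = ascending-lower asc
  open Gap L (q ∷ Q) L<ℓ ℓ<a q∷Q>a
  ℓ<q : ℓ < q
  ℓ<q = <-trans ℓ<a a<q
  lower : arrange f (below ℓ P) (below ℓ (range a (suc j))) ≡ chain L
  lower = trans (cong₂ (arrange f) lower-part (below-range (suc j) (<⇒≤ ℓ<a))) (arrange-[] f L)
  upper : arrange f (above q P) (above q (range a (suc j))) ≡ chain Q
  upper = trans (cong₂ (arrange f)
                  (trans (above-skip L (ℓ ∷ q ∷ Q) (All.map (λ y<ℓ → <⇒≤ (<-trans y<ℓ ℓ<q)) L<ℓ))
                         (above-after (ℓ ∷ q ∷ []) Q (<⇒≤ ℓ<q ∷ ≤-refl ∷ []) (ascending-lower asc′)))
                  future-above)
                (arrange-chain f j′ Q asc′ (<⇒≤ len))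

size : Tree → ℕ
size leaf         = 0
size (node l k r) = size l + suc (size r)

potential : Tree → ℕ
potential leaf         = 0
potential (node l k r) = size l + potential r

potential≤size : ∀ t → potential t ≤ size t
potential≤size leaf         = z≤n
potential≤size (node l k r) = +-monoʳ-≤ (size l) (m≤n⇒m≤1+n (potential≤size r))

size≡length-inorder : ∀ t → size t ≡ length (inorder t)
size≡length-inorder leaf         = refl
size≡length-inorder (node l k r) = sym (begin
    length (inorder l ++ k ∷ inorder r)    ≡⟨ length-++ (inorder l) ⟩
    length (inorder l) + suc (length (inorder r))
      ≡⟨ sym (cong₂ (λ x y → x + suc y) (size≡length-inorder l) (size≡length-inorder r)) ⟩
    size l + suc (size r) ∎)
  where open ≡-Reasoning

keys : List (ℕ × Tree) → List ℕ
keys = map proj₁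

hangs : List (ℕ × Tree) → List Tree
hangs = map proj₂

rightSpine : List (ℕ × Tree) → Tree → Tree
rightSpine []             t = t
rightSpine ((r , A) ∷ cs) t = node A r (rightSpine cs t)

leftSpine : Tree → List (ℕ × Tree) → Tree
leftSpine c []             = c
leftSpine c ((k , r) ∷ ps) = leftSpine (node c k r) ps

-- rightChain h [(k₁,r₁), (k₂,r₂), …] = node h k₁ (node r₁ k₂ (…)): the same keys and
-- subtrees as a left spine, rotated into a right spine.
rightChain : Tree → List (ℕ × Tree) → Tree
rightChain h []             = h
rightChain h ((k , r) ∷ ps) = node h k (rightChain r ps)

weight : List (ℕ × Tree) → ℕ
weight cs = sum (map size (hangs cs))

leftSpine-snoc : ∀ c ps k r → leftSpine c (ps ++ [ (k , r) ]) ≡ node (leftSpine c ps) k r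
leftSpine-snoc c []             k r = refl
leftSpine-snoc c ((k′ , r′) ∷ ps) k r = leftSpine-snoc (node c k′ r′) ps k r

inorder-leftSpine : ∀ l x h ps → inorder (leftSpine (node l x h) ps) ≡ inorder l ++ x ∷ inorder (rightChain h ps)
inorder-leftSpine l x h []             = refl
inorder-leftSpine l x h ((k , r) ∷ ps) =
  trans (inorder-leftSpine (node l x h) k r ps) (++-assoc (inorder l) (x ∷ inorder h) _)

potential-leftSpine : ∀ l x h ps →
  potential (leftSpine (node l x h) ps) ≡ size l + (length ps + potential (rightChain h ps))
potential-leftSpine l x h []             = refl
potential-leftSpine l x h ((k , r) ∷ ps) =
  trans (potential-leftSpine (node l x h) k r ps) (rearrange (size l) (size h) (length ps) (potential (rightChain r ps)))
  where
  rearrange : ∀ a b c d → (a + suc b) + (c + d) ≡ a + (suc c + (b + d))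
  rearrange = solve-∀

potential-rightSpine : ∀ cs t → potential (rightSpine cs t) ≡ weight cs + potential t
potential-rightSpine []             t = refl
potential-rightSpine ((r , A) ∷ cs) t =
  trans (cong (size A +_) (potential-rightSpine cs t)) (sym (+-assoc (size A) (weight cs) (potential t)))

size-rightSpine : ∀ cs t → size (rightSpine cs t) ≡ weight cs + length cs + size t
size-rightSpine []             t = refl
size-rightSpine ((r , A) ∷ cs) t =
  trans (cong (λ n → size A + suc n) (size-rightSpine cs t)) (rearrange (size A) (weight cs) (length cs) (size t))
  where
  rearrange : ∀ a w c s → a + suc (w + c + s) ≡ a + w + suc c + s
  rearrange = solve-∀

leftmost : ∀ l x r → Σ[ m ∈ ℕ ] Σ[ h ∈ Tree ] Σ[ ps ∈ List (ℕ × Tree) ] node l x r ≡ leftSpine (node leaf m h) ps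
leftmost leaf             x r = x , r , [] , refl
leftmost (node l′ x′ r′) x r with leftmost l′ x′ r′
... | m , h , ps , eq = m , h , ps ++ [ (x , r) ] , trans (cong (λ t → node t x r) eq) (sym (leftSpine-snoc _ ps x r))

minimum-decomposition : ∀ B {s j} → inorder B ≡ range s (suc j) →
  Σ[ h ∈ Tree ] Σ[ ps ∈ List (ℕ × Tree) ]
    (B ≡ leftSpine (node leaf s h) ps × inorder (rightChain h ps) ≡ range (suc s) j)
minimum-decomposition leaf ()
minimum-decomposition (node l x r) eq with leftmost l x r
... | m , h , ps , shape with ∷-injective (trans (sym (trans (cong inorder shape) (inorder-leftSpine leaf m h ps))) eq)
...   | refl , rest = h , ps , shape , rest

ascending-keys : ∀ {a} h ps → Ascending a (inorder (rightChain h ps)) → Ascending a (keys ps)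
ascending-keys h []             _   = done
ascending-keys h ((k , r) ∷ ps) asc with ascending-drop (inorder h) asc
... | a≤k , asc′ = next a≤k (ascending-keys r ps asc′)

ascending-spine : ∀ {s j} h ps → inorder (rightChain h ps) ≡ range s j → Ascending s (keys ps)
ascending-spine {s} {j} h ps keys-eq = ascending-keys h ps (subst (Ascending s) (sym keys-eq) (ascending-range s j))

data NextKey (a : ℕ) : List (ℕ × Tree) → Set where
  hit  : ∀ t ps → Ascending (suc a) (keys ps) → NextKey a ((a , t) ∷ ps)
  miss : ∀ {ps} → Ascending (suc a) (keys ps) → NextKey a ps

next-key : ∀ {a} ps → Ascending a (keys ps) → NextKey a ps
next-key []             done = miss done
next-key ((k , t) ∷ ps) (next a≤k asc) with m≤n⇒m<n∨m≡n a≤k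
... | inj₁ a<k  = miss (next a<k asc)
... | inj₂ refl = hit t ps asc

searchPath-here : ∀ s l r → searchPath s (node l s r) ≡ ([ s ] , l ∷ r ∷ [])
searchPath-here s l r rewrite <ᵇ-false (≤-refl {s}) = refl

searchPath-left : ∀ {s} c k r → s < k →
  searchPath s (node c k r) ≡ (proj₁ (searchPath s c) ++ [ k ] , proj₂ (searchPath s c) ++ [ r ])
searchPath-left c k r s<k rewrite <ᵇ-true s<k = refl

searchPath-right : ∀ {s} l k r → k < s →
  searchPath s (node l k r) ≡ (k ∷ proj₁ (searchPath s r) , l ∷ proj₂ (searchPath s r))
searchPath-right l k r k<s rewrite <ᵇ-false (<⇒≤ k<s) | <ᵇ-true k<s = refl

searchPath-leftSpine : ∀ {s} c ps → All (s <_) (keys ps) →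
  searchPath s (leftSpine c ps) ≡ (proj₁ (searchPath s c) ++ keys ps , proj₂ (searchPath s c) ++ hangs ps)
searchPath-leftSpine c [] [] = cong₂ _,_ (sym (++-identityʳ _)) (sym (++-identityʳ _))
searchPath-leftSpine {s} c ((k , r) ∷ ps) (s<k ∷ s<ps)
  rewrite searchPath-leftSpine (node c k r) ps s<ps | searchPath-left c k r s<k =
  cong₂ _,_ (++-assoc (proj₁ (searchPath s c)) [ k ] _) (++-assoc (proj₂ (searchPath s c)) [ r ] _)

searchPath-rightSpine : ∀ {s} cs t → All (_< s) (keys cs) →
  searchPath s (rightSpine cs t) ≡ (keys cs ++ proj₁ (searchPath s t) , hangs cs ++ proj₂ (searchPath s t))
searchPath-rightSpine []             t []           = refl
searchPath-rightSpine ((r , A) ∷ cs) t (r<s ∷ cs<s)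
  rewrite searchPath-right A r (rightSpine cs t) r<s | searchPath-rightSpine cs t cs<s = refl

searchPath-minimum : ∀ {s} cs h ps → All (_< s) (keys cs) → All (s <_) (keys ps) →
  searchPath s (rightSpine cs (leftSpine (node leaf s h) ps))
    ≡ (keys cs ++ s ∷ keys ps , hangs cs ++ leaf ∷ h ∷ hangs ps)
searchPath-minimum {s} cs h ps cs<s s<ps
  rewrite searchPath-rightSpine cs (leftSpine (node leaf s h) ps) cs<s
        | searchPath-leftSpine (node leaf s h) ps s<ps
        | searchPath-here s leaf h = refl

fill-node : ∀ {l k r hs l′ hs′ r′ hs″} → fill l hs ≡ (l′ , hs′) → fill r hs′ ≡ (r′ , hs″) →
  fill (node l k r) hs ≡ (node l′ k r′ , hs″)
fill-node fill-l fill-r rewrite fill-l | fill-r = refl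

fill-rightSpine : ∀ cs ks hs →
  fill (chain (keys cs ++ ks)) (hangs cs ++ hs) ≡ map₁ (rightSpine cs) (fill (chain ks) hs)
fill-rightSpine []             ks hs = refl
fill-rightSpine ((r , A) ∷ cs) ks hs rewrite fill-rightSpine cs ks hs = refl

fill-rightChain : ∀ h ps → fill (chain (keys ps)) (h ∷ hangs ps) ≡ (rightChain h ps , [])
fill-rightChain h []             = refl
fill-rightChain h ((k , r) ∷ ps) rewrite fill-rightChain r ps = refl

greedyStep-unfold : ∀ s x xs T {P H} → searchPath s T ≡ (P , H) →
  greedyStep s (x ∷ xs) T ≡ proj₁ (fill (arrange (length P) P (x ∷ xs)) H)
greedyStep-unfold s x xs T path rewrite path = refl

-- The fuel `length P` suffices for the part of P after any entry.
length-middle : ∀ {A : Set} (L : List A) x Q → length Q < length (L ++ x ∷ Q)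
length-middle L x Q = subst (length Q <_) (sym (length-++ L)) (m≤n+m (suc (length Q)) (length L))

step-root : ∀ A x B j → greedyStep x (range (suc x) j) (node A x B) ≡ node A x B
step-root A x B zero    = refl
step-root A x B (suc j) =
  trans (greedyStep-unfold x (suc x) (range (suc (suc x)) j) (node A x B) (searchPath-here x A B))
        (cong (λ t → proj₁ (fill t (A ∷ B ∷ []))) (arrange-miss 1 j [] x [] [] (n<1+n x) done (s≤s z≤n)))

step-miss : ∀ cs {s} h ps j → All (_< s) (keys cs) → Ascending (suc (suc s)) (keys ps) →
  greedyStep s (range (suc s) (suc j)) (rightSpine cs (leftSpine (node leaf s h) ps))
    ≡ node (rightSpine cs leaf) s (rightChain h ps)
step-miss cs {s} h ps j cs<s asc = begin
    greedyStep s (range (suc s) (suc j)) before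
  ≡⟨ greedyStep-unfold s (suc s) (range (suc (suc s)) j) before
       (searchPath-minimum cs h ps cs<s (All.map <⇒≤ (ascending-lower asc))) ⟩
    proj₁ (fill (arrange (length P) P (range (suc s) (suc j))) H)
  ≡⟨ cong (λ t → proj₁ (fill t H))
          (arrange-miss (length P) j (keys cs) s (keys ps) cs<s (n<1+n s) asc (length-middle (keys cs) s (keys ps))) ⟩
    proj₁ (fill (node (chain (keys cs)) s (chain (keys ps))) H)
  ≡⟨ cong proj₁ (fill-node fill-context (fill-rightChain h ps)) ⟩
    node (rightSpine cs leaf) s (rightChain h ps) ∎
  where
  open ≡-Reasoning
  before = rightSpine cs (leftSpine (node leaf s h) ps)
  P = keys cs ++ s ∷ keys ps
  H = hangs cs ++ leaf ∷ h ∷ hangs ps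
  fill-context : fill (chain (keys cs)) H ≡ (rightSpine cs leaf , h ∷ hangs ps)
  fill-context = subst (λ ks → fill (chain ks) H ≡ (rightSpine cs leaf , h ∷ hangs ps))
                       (++-identityʳ (keys cs)) (fill-rightSpine cs [] (leaf ∷ h ∷ hangs ps))

step-hit : ∀ cs {s} h h′ ps j → All (_< s) (keys cs) → Ascending (suc (suc s)) (keys ps) →
  greedyStep s (range (suc s) (suc j)) (rightSpine cs (leftSpine (node leaf s h) ((suc s , h′) ∷ ps)))
    ≡ node (rightSpine cs (node leaf s h)) (suc s) (rightChain h′ ps)
step-hit cs {s} h h′ ps j cs<s asc = begin
    greedyStep s (range (suc s) (suc j)) before
  ≡⟨ greedyStep-unfold s (suc s) (range (suc (suc s)) j) before
       (searchPath-minimum cs h ((suc s , h′) ∷ ps) cs<s (≤-refl ∷ All.map <⇒≤ (ascending-lower asc))) ⟩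
    proj₁ (fill (arrange (length P) P (range (suc s) (suc j))) H)
  ≡⟨ cong (λ t → proj₁ (fill t H)) arrangement ⟩
    proj₁ (fill (node (chain (keys cs ++ [ s ])) (suc s) (chain (keys ps))) H)
  ≡⟨ cong proj₁ (fill-node (fill-rightSpine cs [ s ] (leaf ∷ h ∷ h′ ∷ hangs ps)) (fill-rightChain h′ ps)) ⟩
    node (rightSpine cs (node leaf s h)) (suc s) (rightChain h′ ps) ∎
  where
  open ≡-Reasoning
  before = rightSpine cs (leftSpine (node leaf s h) ((suc s , h′) ∷ ps))
  P = keys cs ++ s ∷ suc s ∷ keys ps
  H = hangs cs ++ leaf ∷ h ∷ h′ ∷ hangs ps
  arrangement : arrange (length P) P (range (suc s) (suc j)) ≡ node (chain (keys cs ++ [ s ])) (suc s) (chain (keys ps))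
  arrangement = trans (cong (λ X → arrange (length P) X (range (suc s) (suc j))) (sym (++-assoc (keys cs) [ s ] _)))
    (arrange-hit (length P) j (keys cs ++ [ s ]) (keys ps) (++⁺ (All.map m<n⇒m<1+n cs<s) (n<1+n s ∷ [])) asc
       (<-trans (n<1+n _) (length-middle (keys cs) s (suc s ∷ keys ps))))

pathLength-minimum : ∀ cs {s} h ps → All (_< s) (keys cs) → All (s <_) (keys ps) →
  length (proj₁ (searchPath s (rightSpine cs (leftSpine (node leaf s h) ps)))) ≡ length cs + suc (length ps)
pathLength-minimum cs h ps cs<s s<ps =
  trans (cong (length ∘ proj₁) (searchPath-minimum cs h ps cs<s s<ps))
        (trans (length-++ (keys cs)) (cong₂ (λ c p → c + suc p) (length-map proj₁ cs) (length-map proj₁ ps)))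

potential-minimum : ∀ cs s h ps →
  potential (rightSpine cs (leftSpine (node leaf s h) ps)) ≡ weight cs + (length ps + potential (rightChain h ps))
potential-minimum cs s h ps = trans (potential-rightSpine cs _) (cong (weight cs +_) (potential-leftSpine leaf s h ps))

-- The budget inequalities for the three kinds of step (c = |cs|, p = |ps|, w = weight cs,
-- o = potential of the rotated spine, z = size of the subtree right of s).
budget-last : ∀ c p w o → c + suc p + 0 ≤ 4 * 1 + (w + (p + o)) + 2 * c
budget-last c p w o = m+n≤o⇒m≤o _ (≤-reflexive (balance c p w o))
  where
  balance : ∀ c p w o → c + suc p + 0 + (3 + w + o + c) ≡ 4 * 1 + (w + (p + o)) + 2 * c
  balance = solve-∀

budget-miss : ∀ c p w o j → c + suc p + (4 * suc j + (w + c + 0 + o) + 2 * 1) ≤ 4 * suc (suc j) + (w + (p + o)) + 2 * c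
budget-miss c p w o j = m+n≤o⇒m≤o _ (≤-reflexive (balance c p w o j))
  where
  balance : ∀ c p w o j → c + suc p + (4 * suc j + (w + c + 0 + o) + 2 * 1) + 1 ≡ 4 * suc (suc j) + (w + (p + o)) + 2 * c
  balance = solve-∀

budget-hit : ∀ c p w z o j →
  c + suc (suc p) + (1 + (4 * j + (w + c + suc z + o) + 2 * 1)) ≤ 4 * suc (suc j) + (w + (suc p + (z + o))) + 2 * c
budget-hit c p w z o j = m+n≤o⇒m≤o _ (≤-reflexive (balance c p w z o j))
  where
  balance : ∀ c p w z o j →
    c + suc (suc p) + (1 + (4 * j + (w + c + suc z + o) + 2 * 1)) + 3 ≡ 4 * suc (suc j) + (w + (suc p + (z + o))) + 2 * c
  balance = solve-∀

mutual
  -- Amortized cost of GreedyFuture on the run s, s+1, …, s+j-1, for a tree that is a spine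
  -- context cs of keys < s above a subtree B holding exactly the keys s, …, s+j-1:
  -- every search costs at most 4 plus the drop of the potential, plus 2 per context node.
  cost-bound : ∀ j {s} cs B → All (_< s) (keys cs) → inorder B ≡ range s j →
    greedyCost (rightSpine cs B) (range s j) ≤ 4 * j + potential (rightSpine cs B) + 2 * length cs
  cost-bound zero    cs B _    _       = z≤n
  cost-bound (suc j) {s} cs B cs<s keys-B =
    let (h , ps , B≡spine , rest) = minimum-decomposition B keys-B
    in subst (λ t → greedyCost (rightSpine cs t) (range s (suc j)) ≤ 4 * suc j + potential (rightSpine cs t) + 2 * length cs)
             (sym B≡spine) (cost-bound-minimum j cs h ps cs<s rest (next-key ps (ascending-spine h ps rest)))

  cost-bound-minimum : ∀ j {s} cs h ps → All (_< s) (keys cs) → inorder (rightChain h ps) ≡ range (suc s) j →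
    NextKey (suc s) ps →
    greedyCost (rightSpine cs (leftSpine (node leaf s h) ps)) (range s (suc j))
      ≤ 4 * suc j + potential (rightSpine cs (leftSpine (node leaf s h) ps)) + 2 * length cs
  cost-bound-minimum zero {s} cs h ps cs<s rest _ = begin
      length (proj₁ (searchPath s before)) + 0
    ≡⟨ cong (_+ 0) (pathLength-minimum cs h ps cs<s (ascending-lower (ascending-spine h ps rest))) ⟩
      length cs + suc (length ps) + 0
    ≤⟨ budget-last (length cs) (length ps) (weight cs) (potential (rightChain h ps)) ⟩
      4 * 1 + (weight cs + (length ps + potential (rightChain h ps))) + 2 * length cs
    ≡⟨ cong (λ φ → 4 * 1 + φ + 2 * length cs) (sym (potential-minimum cs s h ps)) ⟩
      4 * 1 + potential before + 2 * length cs ∎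
    where
    open ≤-Reasoning
    before = rightSpine cs (leftSpine (node leaf s h) ps)
  cost-bound-minimum (suc j) {s} cs h ps cs<s rest (miss asc) = begin
      length (proj₁ (searchPath s before)) + greedyCost (greedyStep s future before) future
    ≡⟨ cong₂ _+_ (pathLength-minimum cs h ps cs<s (All.map <⇒≤ (ascending-lower asc)))
                 (cong (λ t → greedyCost t future) (step-miss cs h ps j cs<s asc)) ⟩
      length cs + suc (length ps) + greedyCost (rightSpine [ (s , L) ] (rightChain h ps)) future
    ≤⟨ +-monoʳ-≤ (length cs + suc (length ps)) (cost-bound (suc j) [ (s , L) ] (rightChain h ps) (n<1+n s ∷ []) rest) ⟩
      length cs + suc (length ps) + (4 * suc j + (size L + potential (rightChain h ps)) + 2 * 1)
    ≡⟨ cong (λ z → length cs + suc (length ps) + (4 * suc j + (z + potential (rightChain h ps)) + 2 * 1)) (size-rightSpine cs leaf) ⟩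
      length cs + suc (length ps) + (4 * suc j + (weight cs + length cs + 0 + potential (rightChain h ps)) + 2 * 1)
    ≤⟨ budget-miss (length cs) (length ps) (weight cs) (potential (rightChain h ps)) j ⟩
      4 * suc (suc j) + (weight cs + (length ps + potential (rightChain h ps))) + 2 * length cs
    ≡⟨ cong (λ φ → 4 * suc (suc j) + φ + 2 * length cs) (sym (potential-minimum cs s h ps)) ⟩
      4 * suc (suc j) + potential before + 2 * length cs ∎
    where
    open ≤-Reasoning
    before = rightSpine cs (leftSpine (node leaf s h) ps)
    L = rightSpine cs leaf
    future = range (suc s) (suc j)
  cost-bound-minimum (suc j) {s} cs h .((suc s , h′) ∷ ps′) cs<s rest (hit h′ ps′ asc) = begin
      length (proj₁ (searchPath s before)) + greedyCost (greedyStep s future before) future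
    ≡⟨ cong₂ _+_ (pathLength-minimum cs h spine cs<s (≤-refl ∷ All.map <⇒≤ (ascending-lower asc)))
                 (cong (λ t → greedyCost t future) (step-hit cs h h′ ps′ j cs<s asc)) ⟩
      length cs + suc (length spine) + greedyCost after future
    ≡⟨ cong (λ x → length cs + suc (length spine) + x)
            (cong₂ _+_ (cong (length ∘ proj₁) (searchPath-here (suc s) L (rightChain h′ ps′)))
                       (cong (λ t → greedyCost t future′) (step-root L (suc s) (rightChain h′ ps′) j))) ⟩
      length cs + suc (length spine) + (1 + greedyCost after future′)
    ≤⟨ +-monoʳ-≤ (length cs + suc (length spine))
         (+-monoʳ-≤ 1 (cost-bound j [ (suc s , L) ] (rightChain h′ ps′) (n<1+n (suc s) ∷ []) (range-suffix (inorder h) rest))) ⟩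
      length cs + suc (length spine) + (1 + (4 * j + (size L + potential (rightChain h′ ps′)) + 2 * 1))
    ≡⟨ cong (λ z → length cs + suc (length spine) + (1 + (4 * j + (z + potential (rightChain h′ ps′)) + 2 * 1)))
            (size-rightSpine cs (node leaf s h)) ⟩
      length cs + suc (length spine) + (1 + (4 * j + (weight cs + length cs + suc (size h) + potential (rightChain h′ ps′)) + 2 * 1))
    ≤⟨ budget-hit (length cs) (length ps′) (weight cs) (size h) (potential (rightChain h′ ps′)) j ⟩
      4 * suc (suc j) + (weight cs + (length spine + potential (rightChain h spine))) + 2 * length cs
    ≡⟨ cong (λ φ → 4 * suc (suc j) + φ + 2 * length cs) (sym (potential-minimum cs s h spine)) ⟩
      4 * suc (suc j) + potential before + 2 * length cs ∎
    where
    open ≤-Reasoning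
    spine = (suc s , h′) ∷ ps′
    before = rightSpine cs (leftSpine (node leaf s h) spine)
    L = rightSpine cs (node leaf s h)
    after = node L (suc s) (rightChain h′ ps′)
    future = range (suc s) (suc j)
    future′ = range (suc (suc s)) j

-- GreedyFuture on the searches 1, 2, …, n costs at most 4n plus the initial potential,
-- and the potential of a tree never exceeds its size n.
theorem1 : ∃[ c ] ∃[ n₀ ] ((n : ℕ) → n₀ ≤ n → (T₀ : Tree) →
             inorder T₀ ≡ applyUpTo suc n →
             greedyCost T₀ (applyUpTo suc n) ≤ c * n)
theorem1 = 5 , 0 , λ n _ → linear n
  where
  linear : ∀ n T₀ → inorder T₀ ≡ applyUpTo suc n → greedyCost T₀ (applyUpTo suc n) ≤ 5 * n
  linear n T₀ sorted = begin
      greedyCost T₀ (applyUpTo suc n)  ≡⟨ cong (greedyCost T₀) searches ⟩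
      greedyCost T₀ (range 1 n)        ≤⟨ cost-bound n [] T₀ [] (trans sorted searches) ⟩
      4 * n + potential T₀ + 2 * 0     ≤⟨ +-monoˡ-≤ (2 * 0) (+-monoʳ-≤ (4 * n) potential≤n) ⟩
      4 * n + n + 2 * 0                ≡⟨ five n ⟩
      5 * n                            ∎
    where
    open ≤-Reasoning
    searches : applyUpTo suc n ≡ range 1 n
    searches = applyUpTo≡range suc 1 n (λ _ → refl)
    potential≤n : potential T₀ ≤ n
    potential≤n = ≤-trans (potential≤size T₀)
      (≤-reflexive (trans (size≡length-inorder T₀) (trans (cong length sorted) (length-applyUpTo suc n))))
    five : ∀ n → 4 * n + n + 2 * 0 ≡ 5 * n
    five = solve-∀
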